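{- Let $A$ be a connected simple graph on $[n]$ with $n>2$, $B$ its binding graph on $[n_1]$ ($n_1=n(n+1)/2$), $\hat B=(m_{ij})$ the stable graph of $B$, and $\Phi=(\phi_{ij})$ the graph with $\phi_{ij}=x_0$ if $i\ne j$ and $(i,j)$ is not a binding edge of $B$, and $\phi_{ij}=m_{ij}$ otherwise (i.e. on the diagonal and on binding edges). Let $x\in\mathrm{Var}$ be a variable not occurring in $\Phi$, and define $\Theta=(\theta_{ij})$ by $\theta_{ii}=\phi_{ii}$ for binding vertices $i\in\{n+1,\dots,n_1\}$, $\theta_{ij}=x$ if $(i,j)$ is a binding edge, and $\theta_{ij}=x_0$ otherwise. Then $\hat\Phi\approx\hat\Theta$ and $\mathrm{WL}(\Phi)\approx\mathrm{WL}(\Theta)$.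
   Context: Labels are independent commuting indeterminates $x_0,x_1,\dots$; $\mathrm{Var}=\{x_1,x_2,\dots\}$. A graph of order $N$ is a symmetric $N\times N$ matrix over $\{x_0\}\cup\mathrm{Var}$; $\dim$ is the number of distinct entries. A simple graph has all diagonal entries $x_0$ and at most two distinct entries. $G\approx H$ means $g_{ij}=g_{st}\iff h_{ij}=h_{st}$ for all $i,j,s,t$. An equivalent variable substitution replaces the entries of a matrix by variables of $\mathrm{Var}$, equal entries by equal variables, distinct by distinct. Stable graph $\hat G$ (SaS process): $G_1$ is $G$ with its diagonal entries replaced by an equivalent variable substitution with fresh variables not occurring off the diagonal; $G_{i+1}$ is obtained from $G_i^2$ (commutative polynomial ring) by an equivalent variable substitution; $\hat G:=G_t$ for the first $t$ with $\dim(G_t)=\dim(G_{t+1})$. WL process: $x\diamond y$ is a non-commutative formal product of indeterminates ($x\diamond y=x'\diamond y'$ iff $x=x',y=y'$); $X\diamond Y$ has $(i,j)$ entry the formal sum $\sum_k x_{ik}\diamond y_{kj}$; $X_1=G_1$, $X_{i+1}$ obtained from $X_i\diamond X_i$ by an equivalent variable substitution, $\mathrm{WL}(G):=X_t$ for the first $t$ with $\dim(X_t)=\dim(X_{t+1})$. The binding graph $B$ of a simple graph $A$ on $[n]$: the simple graph on $[n_1]$ whose subgraph induced on $[n]$ is $A$ and where each pair of distinct $u,v\in[n]$ has a unique vertex $p\in\{n+1,\dots,n_1\}$ adjacent exactly to $u$ and $v$; the edges $(u,p),(v,p)$ are binding edges; vertices of $[n]$ are basic, the others binding vertices. -}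

module Defs where

open import Data.Nat using (ℕ; zero; suc; _+_; _*_; _≤_; _<_; _⊓_; _⊔_; _≟_; _≤?_)
open import Data.Fin using (Fin; toℕ; _↑ˡ_; _↑ʳ_)
import Data.Fin as F
open import Data.Bool using (Bool; true; false; _∧_; _∨_; not; if_then_else_)
open import Data.List using (List; map; concatMap; allFin; length; deduplicate)
open import Data.List.Relation.Binary.Permutation.Propositional using (_↭_)
open import Data.Product using (Σ; _×_; _,_; ∃)
open import Data.Sum using (_⊎_)
open import Relation.Nullary using (¬_)
open import Relation.Nullary.Decidable using (⌊_⌋)
open import Relation.Binary.PropositionalEquality using (_≡_; _≢_)

-- Labels: the indeterminate x_k is encoded by the natural number k.
-- x_0 is 0; Var = {x_1, x_2, ...} = positive naturals.
Label : Set
Label = ℕ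

Mat : ℕ → Set
Mat N = Fin N → Fin N → Label

_⇔′_ : Set → Set → Set
P ⇔′ Q = (P → Q) × (Q → P)

_≈_ : ∀ {N} → Mat N → Mat N → Set
G ≈ H = ∀ i j s t → (G i j ≡ G s t) ⇔′ (H i j ≡ H s t)

Symmetric : ∀ {N} → Mat N → Set
Symmetric G = ∀ i j → G i j ≡ G j i

entries : ∀ {N} → Mat N → List Label
entries {N} G = concatMap (λ i → map (G i) (allFin N)) (allFin N)

dim : ∀ {N} → Mat N → ℕ
dim G = length (deduplicate _≟_ (entries G))

SimpleGraph : ∀ {N} → Mat N → Set
SimpleGraph G = (∀ i → G i i ≡ 0) × Symmetric G × (dim G ≤ 2)

Edge : ∀ {N} → Mat N → Fin N → Fin N → Set
Edge G i j = (i ≢ j) × (G i j ≢ 0)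

isEdge : ∀ {N} → Mat N → Fin N → Fin N → Bool
isEdge G i j = not ⌊ i F.≟ j ⌋ ∧ not ⌊ G i j ≟ 0 ⌋

data Walk {N} (G : Mat N) : Fin N → Fin N → Set where
  here : ∀ {u} → Walk G u u
  step : ∀ {u w v} → Edge G u w → Walk G w v → Walk G u v

Connected : ∀ {N} → Mat N → Set
Connected G = ∀ u v → Walk G u v

-- Binding graph.  B lives on Fin (n + m); basic vertices are
-- (u ↑ˡ m) (u : Fin n), binding vertices are (n ↑ʳ p) (p : Fin m).

IsBindingGraph : ∀ {n m} → Mat n → Mat (n + m) → Set
IsBindingGraph {n} {m} A B =
  SimpleGraph B
  × (∀ (i j : Fin n) → B ((i ↑ˡ m)) ((j ↑ˡ m)) ≡ A i j)
  × (∀ (u v : Fin n) → u ≢ v →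
       Σ (Fin m) λ p →
         (∀ w → Edge B ((n ↑ʳ p)) w ⇔′ ((w ≡ (u ↑ˡ m)) ⊎ (w ≡ (v ↑ˡ m))))
         × (∀ q → (∀ w → Edge B ((n ↑ʳ q)) w ⇔′ ((w ≡ (u ↑ˡ m)) ⊎ (w ≡ (v ↑ˡ m))))
                → q ≡ p))

isBindingVertex : ∀ {n m} → Fin (n + m) → Bool
isBindingVertex {n} i = ⌊ n ≤? toℕ i ⌋

-- binding edges: edges of B joining a basic and a binding vertex
-- (in B every edge at a binding vertex is of this kind)
isBindingEdge : ∀ {n m} → Mat (n + m) → Fin (n + m) → Fin (n + m) → Bool
isBindingEdge {n} {m} B i j =
  isEdge B i j ∧ (isBindingVertex {n} {m} i ∨ isBindingVertex {n} {m} j)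

PhiGraph : ∀ {n m} → Mat (n + m) → Mat (n + m) → Mat (n + m)
PhiGraph {n} {m} B M i j =
  if ⌊ i F.≟ j ⌋ ∨ isBindingEdge {n} {m} B i j then M i j else 0

ThetaGraph : ∀ {n m} → Mat (n + m) → Mat (n + m) → Label → Mat (n + m)
ThetaGraph {n} {m} B Φ x i j =
  if ⌊ i F.≟ j ⌋ ∧ isBindingVertex {n} {m} i then Φ i j
  else if isBindingEdge {n} {m} B i j then x else 0

-- The (i,j) entry of a "square" is a formal sum over k of
-- products of g_ik and g_kj, represented as a list of pairs of labels
-- compared up to permutation (formal sums are commutative).
--  * SaS (commutative polynomial ring): the monomial x_a x_b is the
--    unordered pair, encoded as (min a b , max a b).
--  * WL (non-commutative ⋄): x_a ⋄ x_b is the ordered pair (a , b).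

commProd : Label → Label → Label × Label
commProd a b = (a ⊓ b , a ⊔ b)

wlProd : Label → Label → Label × Label
wlProd a b = (a , b)

square : ∀ {N} → (Label → Label → Label × Label) → Mat N →
         Fin N → Fin N → List (Label × Label)
square {N} prod G i j = map (λ k → prod (G i k) (G k j)) (allFin N)

EVS : ∀ {N} → (Fin N → Fin N → List (Label × Label)) → Mat N → Set
EVS S H = (∀ i j → 1 ≤ H i j)
        × (∀ i j s t → (S i j ↭ S s t) ⇔′ (H i j ≡ H s t))

Init : ∀ {N} → Mat N → Mat N → Set
Init G G₁ = (∀ i j → i ≢ j → G₁ i j ≡ G i j)
          × (∀ i → 1 ≤ G₁ i i)
          × (∀ i s t → s ≢ t → G₁ i i ≢ G s t)
          × (∀ i s → (G i i ≡ G s s) ⇔′ (G₁ i i ≡ G₁ s s))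

-- S is a possible result of the process (SaS when prod = commProd,
-- WL when prod = wlProd) started at G.  seq 0 = G₁, seq k = G_{k+1}.
IsResult : ∀ {N} → (Label → Label → Label × Label) → Mat N → Mat N → Set
IsResult prod G S =
  Σ (ℕ → Mat _) λ seq →
    Init G (seq 0)
    × (∀ k → EVS (square prod (seq k)) (seq (suc k)))
    × Σ ℕ λ t →
        (dim (seq t) ≡ dim (seq (suc t)))
        × (∀ s → s < t → dim (seq s) ≢ dim (seq (suc s)))
        × (∀ i j → S i j ≡ seq t i j)

IsStable : ∀ {N} → Mat N → Mat N → Set
IsStable = IsResult commProd

IsWL : ∀ {N} → Mat N → Mat N → Set
IsWL = IsResult wlProd

-- Both the SaS and the WL process end in the coarsest equitable matrix that refines the
-- initial matrix (diagonal refreshed), so it suffices that Φ and Θ have the same equitable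
-- refiners.  A refiner of Φ refines Θ because the diagonal of the stable graph M of B already
-- tells basic vertices (degree ≥ 3 in B, as A is connected and n > 2) from binding vertices
-- (degree 2).  Conversely, in an equitable refiner X of Θ the entry at a basic pair {u, v}
-- determines, through the summand at the binding vertex of {u, v}, a diagonal entry at a
-- binding vertex, and on the binding diagonal M determines the A-entry of the bound pair.
-- Hence X refines B, so it refines M, and with it Φ.

module Submission where

open import Defs
open import Data.Bool using (Bool; true; false; if_then_else_)
open import Data.Bool.Properties using (∧-zeroʳ; ∧-identityʳ; ∨-zeroʳ)
open import Data.Nat using (ℕ; zero; suc; _+_; _*_; _<_; _≤_; _⊔_; _≟_; _≤?_; z≤n; s≤s)
open import Data.Nat.Properties
  using (≤-total; m≤n⇒m⊓n≡m; m≤n⇒m⊔n≡n; ⊓-comm; ⊔-comm; ⊔-idem; <-irrefl; ≤-trans; <⇒≤; <⇒≱; m≤m+n;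
         n<1+n; n≢0⇒n>0; <-irrelevant; +-suc; *-cancelˡ-≡; +-cancelʳ-≡; module ≤-Reasoning)
open import Data.Nat.Tactic.RingSolver using (solve-∀)
open import Data.Fin using (Fin; toℕ; _↑ˡ_; _↑ʳ_)
import Data.Fin as F
import Data.Fin.Properties as FP
open import Data.List using (List; []; _∷_; map; allFin; length; deduplicate; concatMap; filter; _++_)
open import Data.List.Properties using (map-∘; map-cong; length-map; length-++; length-tabulate)
open import Data.List.Membership.Propositional using (_∈_)
open import Data.List.Membership.Propositional.Properties
  using (∈-map⁺; ∈-map⁻; ∈-allFin; ∈-deduplicate⁺; ∈-deduplicate⁻; ∈-∃++; ∈-++⁺ˡ; ∈-++⁺ʳ; ∈-++⁻;
         ∈-concatMap⁺; ∈-concatMap⁻; ∈-filter⁺; ∈-filter⁻)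
import Data.List.Relation.Unary.Any as Any
open import Data.List.Relation.Unary.Any using (here; there)
open import Data.List.Relation.Unary.All using ([]; _∷_; lookup)
open import Data.List.Relation.Unary.All.Properties using (¬Any⇒All¬)
import Data.List.Membership.DecPropositional as DecMembership
open import Data.List.Relation.Binary.Subset.Propositional using (_⊆_)
open import Data.List.Relation.Unary.Unique.Propositional using (Unique; _∷_; [])
open import Data.List.Relation.Unary.Unique.DecPropositional.Properties using (deduplicate-!)
import Data.List.Relation.Unary.Unique.Propositional.Properties as UniqueP
open import Data.List.Relation.Binary.Permutation.Propositional using (_↭_; ↭-refl)
open import Data.List.Relation.Binary.Permutation.Propositional.Properties using (∈-resp-↭; map⁺; filter-↭; ↭-length)
open import Data.Product using (Σ; _×_; _,_; ∃; ∃₂; proj₁; proj₂; swap)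
open import Data.Product.Properties using (,-injective)
open import Data.Sum using (_⊎_; inj₁; inj₂)
import Data.Sum as Sum
open import Data.Empty using (⊥-elim)
open import Function using (_∘_; id)
open import Relation.Nullary using (¬_; yes; no; does; ¬?; contradiction)
open import Relation.Nullary.Decidable using (decidable-stable)
import Relation.Unary as U
open import Relation.Binary.PropositionalEquality
  using (_≡_; _≢_; refl; sym; trans; cong; cong₂; subst; subst₂; module ≡-Reasoning)

Product : Set
Product = Label → Label → Label × Label

InjectiveUpToSwap : Product → Set
InjectiveUpToSwap prod = ∀ {a b c d} → prod a b ≡ prod c d → (a ≡ c × b ≡ d) ⊎ (a ≡ d × b ≡ c)

RelabellingCompatible : Product → Set
RelabellingCompatible prod = ∀ (f : Label → Label) →
  ∃ λ (g : Label × Label → Label × Label) → ∀ a b → prod (f a) (f b) ≡ g (prod a b)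

DeterminesCommProd : Product → Set
DeterminesCommProd prod = ∃ λ (h : Label × Label → Label × Label) → ∀ a b → commProd a b ≡ h (prod a b)

commProd-comm : ∀ a b → commProd a b ≡ commProd b a
commProd-comm a b = cong₂ _,_ (⊓-comm a b) (⊔-comm a b)

commProd-sorted : ∀ a b → commProd a b ≡ (a , b) ⊎ commProd a b ≡ (b , a)
commProd-sorted a b with ≤-total a b
... | inj₁ a≤b = inj₁ (cong₂ _,_ (m≤n⇒m⊓n≡m a≤b) (m≤n⇒m⊔n≡n a≤b))
... | inj₂ b≤a = inj₂ (trans (commProd-comm a b) (cong₂ _,_ (m≤n⇒m⊓n≡m b≤a) (m≤n⇒m⊔n≡n b≤a)))

commProd-injectiveUpToSwap : InjectiveUpToSwap commProd
commProd-injectiveUpToSwap {a} {b} {c} {d} eq with commProd-sorted a b | commProd-sorted c d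
... | inj₁ p | inj₁ q = inj₁ (,-injective (trans (sym p) (trans eq q)))
... | inj₁ p | inj₂ q = inj₂ (,-injective (trans (sym p) (trans eq q)))
... | inj₂ p | inj₁ q = inj₂ (swap (,-injective (trans (sym p) (trans eq q))))
... | inj₂ p | inj₂ q = inj₁ (swap (,-injective (trans (sym p) (trans eq q))))

wlProd-injectiveUpToSwap : InjectiveUpToSwap wlProd
wlProd-injectiveUpToSwap refl = inj₁ (refl , refl)

commProd-relabellingCompatible : RelabellingCompatible commProd
commProd-relabellingCompatible f = g , g-commProd
  where
  g : Label × Label → Label × Label
  g (a , b) = commProd (f a) (f b)
  g-commProd : ∀ a b → commProd (f a) (f b) ≡ g (commProd a b)
  g-commProd a b with commProd-sorted a b
  ... | inj₁ p = sym (cong g p)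
  ... | inj₂ p = trans (commProd-comm (f a) (f b)) (sym (cong g p))

wlProd-relabellingCompatible : RelabellingCompatible wlProd
wlProd-relabellingCompatible f = (λ (a , b) → (f a , f b)) , λ a b → refl

commProd-determinesCommProd : DeterminesCommProd commProd
commProd-determinesCommProd = (λ p → p) , λ a b → refl

wlProd-determinesCommProd : DeterminesCommProd wlProd
wlProd-determinesCommProd = (λ (a , b) → commProd a b) , λ a b → refl

module _ {A : Set} where

  ∈-++-remove : ∀ {x z} (as : List A) {bs} → z ∈ as ++ x ∷ bs → z ≢ x → z ∈ as ++ bs
  ∈-++-remove as m z≢x with ∈-++⁻ as m
  ... | inj₁ m′ = ∈-++⁺ˡ m′
  ... | inj₂ (here z≡x) = ⊥-elim (z≢x z≡x)
  ... | inj₂ (there m′) = ∈-++⁺ʳ as m′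

  length-++-∷ : ∀ {x} (as : List A) {bs} → length (as ++ x ∷ bs) ≡ suc (length (as ++ bs))
  length-++-∷ as {bs} = trans (length-++ as) (trans (+-suc _ _) (cong suc (sym (length-++ as))))

  Unique-⊆⇒length≤ : ∀ {xs ys : List A} → Unique xs → xs ⊆ ys → length xs ≤ length ys
  Unique-⊆⇒length≤ [] _ = z≤n
  Unique-⊆⇒length≤ {x ∷ xs} (x∉xs ∷ u) sub with ∈-∃++ (sub (here refl))
  ... | as , bs , refl = subst (suc (length xs) ≤_) (sym (length-++-∷ as))
    (s≤s (Unique-⊆⇒length≤ u λ m → ∈-++-remove as (sub (there m)) λ z≡x → lookup x∉xs m (sym z≡x)))

module _ {N : ℕ} where

  Refines : Mat N → Mat N → Set
  Refines H G = ∀ i j s t → H i j ≡ H s t → G i j ≡ G s t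

  Refines-trans : {X Y Z : Mat N} → Refines X Y → Refines Y Z → Refines X Z
  Refines-trans X⊑Y Y⊑Z i j s t e = Y⊑Z i j s t (X⊑Y i j s t e)

  Refines⇒factor : {H G : Mat N} → Refines H G → ∃ λ (f : Label → Label) → ∀ i j → G i j ≡ f (H i j)
  Refines⇒factor {H} {G} H⊑G = f , f-factor
    where
    f : Label → Label
    f l with FP.any? (λ i → FP.any? (λ j → H i j ≟ l))
    ... | yes (i , j , _) = G i j
    ... | no _ = 0
    f-factor : ∀ i j → G i j ≡ f (H i j)
    f-factor i j with FP.any? (λ i′ → FP.any? (λ j′ → H i′ j′ ≟ H i j))
    ... | yes (i′ , j′ , e) = H⊑G i j i′ j′ (sym e)
    ... | no ∄ = ⊥-elim (∄ (i , j , refl))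

  distinctEntries : Mat N → List Label
  distinctEntries G = deduplicate _≟_ (entries G)

  ∈-distinctEntries : (G : Mat N) → ∀ i j → G i j ∈ distinctEntries G
  ∈-distinctEntries G i j = ∈-deduplicate⁺ _≟_
    (∈-concatMap⁺ (λ i → map (G i) (allFin N)) (Any.map (λ { refl → ∈-map⁺ (G i) (∈-allFin j) }) (∈-allFin i)))

  distinctEntries-∈ : (G : Mat N) → ∀ {z} → z ∈ distinctEntries G → ∃₂ λ i j → z ≡ G i j
  distinctEntries-∈ G m with Any.satisfied (∈-concatMap⁻ (λ i → map (G i) (allFin N)) {xs = allFin N}
                                               (∈-deduplicate⁻ _≟_ (entries G) m))
  ... | i , m′ with ∈-map⁻ (G i) m′
  ... | j , _ , e = i , j , e

  dim-≡⇒Refines : {H G : Mat N} → Refines H G → dim G ≡ dim H → Refines G H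
  dim-≡⇒Refines {H} {G} H⊑G dim≡ i j s t e with H i j ≟ H s t
  ... | yes Hij≡Hst = Hij≡Hst
  ... | no Hij≢Hst with ∈-∃++ (∈-distinctEntries H s t)
  ...   | as , bs , split = ⊥-elim (<-irrefl dim≡ dimG<dimH)
    where
    open ≤-Reasoning
    f = proj₁ (Refines⇒factor H⊑G)
    f-factor = proj₂ (Refines⇒factor H⊑G)
    other : ∀ a b → H a b ≢ H s t → H a b ∈ as ++ bs
    other a b ne = ∈-++-remove as (subst (H a b ∈_) split (∈-distinctEntries H a b)) ne
    covered : distinctEntries G ⊆ map f (as ++ bs)
    covered m with distinctEntries-∈ G m
    ... | a , b , refl with H a b ≟ H s t
    ... | no ne = subst (_∈ map f (as ++ bs)) (sym (f-factor a b)) (∈-map⁺ f (other a b ne))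
    ... | yes Hab≡Hst = subst (_∈ map f (as ++ bs)) (sym (trans (H⊑G a b s t Hab≡Hst) (trans (sym e) (f-factor i j))))
                              (∈-map⁺ f (other i j Hij≢Hst))
    dimG<dimH : dim G < dim H
    dimG<dimH = begin-strict
      dim G                       ≤⟨ Unique-⊆⇒length≤ (deduplicate-! _≟_ (entries G)) covered ⟩
      length (map f (as ++ bs))   ≡⟨ length-map f (as ++ bs) ⟩
      length (as ++ bs)           <⟨ n<1+n _ ⟩
      suc (length (as ++ bs))     ≡⟨ sym (length-++-∷ as) ⟩
      length (as ++ H s t ∷ bs)   ≡⟨ cong length (sym split) ⟩
      dim H                       ∎

  SimpleGraph⇒nonzero-entries-equal : {G : Mat N} → SimpleGraph G →
    ∀ i j s t → G i j ≢ 0 → G s t ≢ 0 → G i j ≡ G s t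
  SimpleGraph⇒nonzero-entries-equal {G} (diag , _ , dim≤2) i j s t Gij≢0 Gst≢0 with G i j ≟ G s t
  ... | yes Gij≡Gst = Gij≡Gst
  ... | no Gij≢Gst = ⊥-elim (<-irrefl refl (≤-trans (Unique-⊆⇒length≤ unique sub) dim≤2))
    where
    unique : Unique (G i i ∷ G i j ∷ G s t ∷ [])
    unique = ((λ e → Gij≢0 (trans (sym e) (diag i))) ∷ (λ e → Gst≢0 (trans (sym e) (diag i))) ∷ [])
           ∷ (Gij≢Gst ∷ []) ∷ [] ∷ []
    sub : (G i i ∷ G i j ∷ G s t ∷ []) ⊆ distinctEntries G
    sub (here refl) = ∈-distinctEntries G i i
    sub (there (here refl)) = ∈-distinctEntries G i j
    sub (there (there (here refl))) = ∈-distinctEntries G s t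

  DiagonalSeparating : Mat N → Set
  DiagonalSeparating X = ∀ i s t → X i i ≡ X s t → s ≡ t

  DiagonalSeparating-≢ : {X : Mat N} → DiagonalSeparating X → ∀ {i j s t} → i ≢ j → X i j ≡ X s t → s ≢ t
  DiagonalSeparating-≢ sep {i} {j} i≢j e refl = i≢j (sep _ i j (sym e))

  Equitable : Product → Mat N → Set
  Equitable prod X = ∀ i j s t → X i j ≡ X s t → square prod X i j ↭ square prod X s t

  -- X refines every initial matrix G₁ admissible for G (Init G G₁), whose diagonal is refreshed.
  record RefinesInit (X G : Mat N) : Set where
    constructor mkRefinesInit
    field
      separating  : DiagonalSeparating X
      diagonal    : ∀ i s → X i i ≡ X s s → G i i ≡ G s s
      offDiagonal : ∀ i j s t → i ≢ j → X i j ≡ X s t → G i j ≡ G s t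

  Refines-RefinesInit : {X Y G : Mat N} → Refines X Y → RefinesInit Y G → RefinesInit X G
  Refines-RefinesInit X⊑Y (mkRefinesInit sep diag off) = mkRefinesInit
    (λ i s t e → sep i s t (X⊑Y i i s t e))
    (λ i s e → diag i s (X⊑Y i i s s e))
    (λ i j s t i≢j e → off i j s t i≢j (X⊑Y i j s t e))

  map-square : (prod prod′ : Product) (X Y : Mat N) (h : Label × Label → Label × Label) → ∀ {i j} →
               (∀ k → prod (X i k) (X k j) ≡ h (prod′ (Y i k) (Y k j))) →
               square prod X i j ≡ map h (square prod′ Y i j)
  map-square prod prod′ X Y h e = trans (map-cong e (allFin N)) (map-∘ (allFin N))

  module _ (prod : Product) where

    ∈-square : (X : Mat N) → ∀ i j k → prod (X i k) (X k j) ∈ square prod X i j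
    ∈-square X i j k = ∈-map⁺ (λ k → prod (X i k) (X k j)) (∈-allFin k)

    square-↭-match : (X : Mat N) → ∀ {i j s t} → square prod X i j ↭ square prod X s t →
                     ∀ k → ∃ λ k′ → prod (X i k) (X k j) ≡ prod (X s k′) (X k′ t)
    square-↭-match X {i} {j} {s} {t} p k
      with ∈-map⁻ (λ k → prod (X s k) (X k t)) (∈-resp-↭ p (∈-square X i j k))
    ... | k′ , _ , e = k′ , e

    Equitable-coarsening : RelabellingCompatible prod → {Q X : Mat N} → Equitable prod Q → Refines Q X →
                           ∀ i j s t → Q i j ≡ Q s t → square prod X i j ↭ square prod X s t
    Equitable-coarsening compatible {Q} {X} equitable Q⊑X i j s t e =
      subst₂ _↭_ (sym (X-square i j)) (sym (X-square s t)) (map⁺ g (equitable i j s t e))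
      where
      f = proj₁ (Refines⇒factor Q⊑X)
      g = proj₁ (compatible f)
      X-square : ∀ a b → square prod X a b ≡ map g (square prod Q a b)
      X-square a b = map-square prod prod X Q g λ k →
        trans (cong₂ prod (proj₂ (Refines⇒factor Q⊑X) a k) (proj₂ (Refines⇒factor Q⊑X) k b))
              (proj₂ (compatible f) (Q a k) (Q k b))

    Equitable-commProd : DeterminesCommProd prod → {X : Mat N} → Equitable prod X → Equitable commProd X
    Equitable-commProd (h , h-comm) {X} equitable i j s t e =
      subst₂ _↭_ (sym (commSquare i j)) (sym (commSquare s t)) (map⁺ h (equitable i j s t e))
      where
      commSquare : ∀ a b → square commProd X a b ≡ map h (square prod X a b)
      commSquare a b = map-square commProd prod X X h λ k → h-comm (X a k) (X k b)

    module _ (injective : InjectiveUpToSwap prod) where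

      -- The k = i summand of square X i j pins down the diagonal entries at the ends.
      Equitable-diagonal-ends : {X : Mat N} → Equitable prod X → DiagonalSeparating X →
        ∀ i j s t → X i j ≡ X s t →
        (X i i ≡ X s s ⊎ X i i ≡ X t t) × (X j j ≡ X s s ⊎ X j j ≡ X t t)
      Equitable-diagonal-ends {X} equitable sep i j s t e = left , right
        where
        left : X i i ≡ X s s ⊎ X i i ≡ X t t
        left with square-↭-match X (equitable i j s t e) i
        ... | k , e′ with injective e′
        ... | inj₁ (e₁ , _) = inj₁ (trans e₁ (cong (X s) (sym (sep i s k e₁))))
        ... | inj₂ (e₁ , _) = inj₂ (trans e₁ (cong (λ z → X z t) (sep i k t e₁)))
        right : X j j ≡ X s s ⊎ X j j ≡ X t t
        right with square-↭-match X (equitable i j s t e) j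
        ... | k , e′ with injective e′
        ... | inj₁ (_ , e₂) = inj₂ (trans e₂ (cong (λ z → X z t) (sep j k t e₂)))
        ... | inj₂ (_ , e₂) = inj₁ (trans e₂ (cong (X s) (sym (sep j s k e₂))))

      module _ {X Y : Mat N} (sep : DiagonalSeparating X) (evs : EVS (square prod X) Y) where

        EVS-separating : DiagonalSeparating Y
        EVS-separating i s t e with square-↭-match X (proj₂ (proj₂ evs i i s t) e) i
        ... | k , e′ with injective e′
        ... | inj₁ (e₁ , e₂) = trans (sep i s k e₁) (sep i k t e₂)
        ... | inj₂ (e₁ , e₂) = trans (sep i s k e₂) (sep i k t e₁)

        EVS-refines : Refines Y X
        EVS-refines i j s t e with square-↭-match X (proj₂ (proj₂ evs i j s t) e) i
        ... | k , e′ with injective e′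
        ... | inj₁ (e₁ , e₂) = trans e₂ (cong (λ z → X z t) (sym (sep i s k e₁)))
        ... | inj₂ (e₁ , e₂) = trans e₂ (cong (X s) (sep i k t e₁))

  square-cong : (prod : Product) {X Y : Mat N} → (∀ i j → X i j ≡ Y i j) → ∀ a b → square prod X a b ≡ square prod Y a b
  square-cong prod X≗Y a b = map-cong (λ k → cong₂ prod (X≗Y a k) (X≗Y k b)) (allFin N)

module Run {N : ℕ} (prod : Product) (injective : InjectiveUpToSwap prod)
           {G : Mat N} {seq : ℕ → Mat N} (init : Init G (seq 0))
           (refinement : ∀ k → EVS (square prod (seq k)) (seq (suc k))) where

  private
    initial-off : ∀ i j → i ≢ j → seq 0 i j ≡ G i j
    initial-off = proj₁ init
    initial-fresh : ∀ i s t → s ≢ t → seq 0 i i ≢ G s t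
    initial-fresh = proj₁ (proj₂ (proj₂ init))
    initial-diagonal : ∀ i s → (G i i ≡ G s s) ⇔′ (seq 0 i i ≡ seq 0 s s)
    initial-diagonal = proj₂ (proj₂ (proj₂ init))

  separating : ∀ k → DiagonalSeparating (seq k)
  separating zero i s t e with s F.≟ t
  ... | yes s≡t = s≡t
  ... | no s≢t = ⊥-elim (initial-fresh i s t s≢t (trans e (initial-off s t s≢t)))
  separating (suc k) = EVS-separating prod injective (separating k) (refinement k)

  refines-initial : ∀ k → Refines (seq k) (seq 0)
  refines-initial zero _ _ _ _ e = e
  refines-initial (suc k) = Refines-trans (EVS-refines prod injective (separating k) (refinement k)) (refines-initial k)

  initial-RefinesInit : RefinesInit (seq 0) G
  initial-RefinesInit = mkRefinesInit (separating 0) (λ i s → proj₂ (initial-diagonal i s)) off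
    where
    off : ∀ i j s t → i ≢ j → seq 0 i j ≡ seq 0 s t → G i j ≡ G s t
    off i j s t i≢j e = trans (sym (initial-off i j i≢j))
      (trans e (initial-off s t (DiagonalSeparating-≢ (separating 0) i≢j e)))

  RefinesInit⇒refines-initial : {Q : Mat N} → RefinesInit Q G → Refines Q (seq 0)
  RefinesInit⇒refines-initial {Q} (mkRefinesInit sep diag off) i j s t e with i F.≟ j
  ... | yes refl = diagonal (sep i s t e)
    where
    diagonal : s ≡ t → seq 0 i i ≡ seq 0 s t
    diagonal refl = proj₁ (initial-diagonal i s) (diag i s e)
  ... | no i≢j = trans (initial-off i j i≢j)
    (trans (off i j s t i≢j e) (sym (initial-off s t (DiagonalSeparating-≢ sep i≢j e))))

  Equitable-refines-run : RelabellingCompatible prod → {Q : Mat N} → Equitable prod Q → RefinesInit Q G →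
                          ∀ k → Refines Q (seq k)
  Equitable-refines-run compatible equitable Q-init zero = RefinesInit⇒refines-initial Q-init
  Equitable-refines-run compatible equitable Q-init (suc k) i j s t e = proj₁ (proj₂ (refinement k) i j s t)
    (Equitable-coarsening prod compatible equitable (Equitable-refines-run compatible equitable Q-init k) i j s t e)

  stabilised⇒equitable : ∀ t → dim (seq t) ≡ dim (seq (suc t)) → Equitable prod (seq t)
  stabilised⇒equitable t dim≡ i j s t′ e = proj₂ (proj₂ (refinement t) i j s t′)
    (dim-≡⇒Refines (EVS-refines prod injective (separating t) (refinement t)) dim≡ i j s t′ e)

  positive : ∀ k i j → i ≡ j ⊎ G i j ≢ 0 → 1 ≤ seq k i j
  positive (suc k) i j _ = proj₁ (refinement k) i j
  positive zero i j diagonal-or-nonzero with i F.≟ j | diagonal-or-nonzero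
  ... | yes refl | _ = proj₁ (proj₂ init) i
  ... | no i≢j | inj₁ i≡j = ⊥-elim (i≢j i≡j)
  ... | no i≢j | inj₂ Gij≢0 = subst (1 ≤_) (sym (initial-off i j i≢j)) (n≢0⇒n>0 Gij≢0)

  symmetric : (∀ a b → prod a b ≡ prod b a) → Symmetric G → ∀ k → Symmetric (seq k)
  symmetric comm G-sym zero i j with i F.≟ j
  ... | yes refl = refl
  ... | no i≢j = trans (initial-off i j i≢j) (trans (G-sym i j) (sym (initial-off j i (i≢j ∘ sym))))
  symmetric comm G-sym (suc k) i j = proj₁ (proj₂ (refinement k) i j j i) (subst (square prod (seq k) i j ↭_)
    (map-cong (λ l → trans (cong₂ prod (symmetric comm G-sym k i l) (symmetric comm G-sym k l j))
                           (comm (seq k l i) (seq k j l))) (allFin N)) ↭-refl)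

record ResultProperties {N : ℕ} (prod : Product) (G S : Mat N) : Set where
  field
    equitable   : Equitable prod S
    refinesInit : RefinesInit S G
    coarsest    : {Q : Mat N} → Equitable prod Q → RefinesInit Q G → Refines Q S
    positive    : ∀ i j → i ≡ j ⊎ G i j ≢ 0 → 1 ≤ S i j
    symmetric   : (∀ a b → prod a b ≡ prod b a) → Symmetric G → Symmetric S

IsResult⇒properties : ∀ {N} {prod : Product} → InjectiveUpToSwap prod → RelabellingCompatible prod →
                      {G S : Mat N} → IsResult prod G S → ResultProperties prod G S
IsResult⇒properties {prod = prod} injective compatible {G} {S} (seq , init , refinement , t , stable , _ , S≗) = record
  { equitable   = λ i j s t′ e → subst₂ _↭_ (sym (square-cong prod S≗ i j)) (sym (square-cong prod S≗ s t′))
                                   (stabilised⇒equitable t stable i j s t′ (trans (sym (S≗ i j)) (trans e (S≗ s t′))))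
  ; refinesInit = Refines-RefinesInit (λ i j s t′ e → trans (sym (S≗ i j)) (trans e (S≗ s t′)))
                                      (Refines-RefinesInit (refines-initial t) initial-RefinesInit)
  ; coarsest    = λ equitable Q-init i j s t′ e →
                    trans (S≗ i j) (trans (Equitable-refines-run compatible equitable Q-init t i j s t′ e) (sym (S≗ s t′)))
  ; positive    = λ i j h → subst (1 ≤_) (sym (S≗ i j)) (positive t i j h)
  ; symmetric   = λ comm G-sym i j → trans (S≗ i j) (trans (symmetric comm G-sym t i j) (sym (S≗ j i)))
  }
  where open Run prod injective init refinement

results-≈ : ∀ {N} {prod : Product} → InjectiveUpToSwap prod → RelabellingCompatible prod →
            {G H : Mat N} →
            (∀ X → Equitable prod X → RefinesInit X G → RefinesInit X H) →
            (∀ X → Equitable prod X → RefinesInit X H → RefinesInit X G) →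
            {S T : Mat N} → IsResult prod G S → IsResult prod H T → S ≈ T
results-≈ injective compatible G⇒H H⇒G S-result T-result i j s t =
  T.coarsest S.equitable (G⇒H _ S.equitable S.refinesInit) i j s t ,
  S.coarsest T.equitable (H⇒G _ T.equitable T.refinesInit) i j s t
  where
  module S = ResultProperties (IsResult⇒properties injective compatible S-result)
  module T = ResultProperties (IsResult⇒properties injective compatible T-result)

length-filter-map : ∀ {A B : Set} {P : B → Set} (P? : U.Decidable P) (f : A → B) (xs : List A) →
                    length (filter P? (map f xs)) ≡ length (filter (P? ∘ f) xs)
length-filter-map P? f [] = refl
length-filter-map P? f (x ∷ xs) with does (P? (f x))
... | true = cong suc (length-filter-map P? f xs)
... | false = length-filter-map P? f xs

module _ {N : ℕ} where

  row : Mat N → Fin N → List Label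
  row G i = map (G i) (allFin N)

  degree : Mat N → Fin N → ℕ
  degree G i = length (filter (λ k → ¬? (G i k ≟ 0)) (allFin N))

  row-↭⇒degree-≡ : {G : Mat N} → ∀ {i s} → row G i ↭ row G s → degree G i ≡ degree G s
  row-↭⇒degree-≡ {G} {i} {s} p = begin
    degree G i                                  ≡⟨ sym (length-filter-map nonzero? (G i) (allFin N)) ⟩
    length (filter nonzero? (row G i))          ≡⟨ ↭-length (filter-↭ nonzero? p) ⟩
    length (filter nonzero? (row G s))          ≡⟨ length-filter-map nonzero? (G s) (allFin N) ⟩
    degree G s                                  ∎
    where
    open ≡-Reasoning
    nonzero? : U.Decidable (_≢ 0)
    nonzero? l = ¬? (l ≟ 0)

  Unique-neighbours⇒≤degree : {G : Mat N} → ∀ {i} (ks : List (Fin N)) → Unique ks →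
                              (∀ {k} → k ∈ ks → G i k ≢ 0) → length ks ≤ degree G i
  Unique-neighbours⇒≤degree {G} {i} ks unique nonzero = Unique-⊆⇒length≤ unique
    λ m → ∈-filter⁺ (λ k → ¬? (G i k ≟ 0)) (∈-allFin _) (nonzero m)

  degree≤-neighbours : {G : Mat N} → ∀ {i} (ks : List (Fin N)) →
                       (∀ k → G i k ≢ 0 → k ∈ ks) → degree G i ≤ length ks
  degree≤-neighbours {G} {i} ks neighbours = Unique-⊆⇒length≤
    (UniqueP.filter⁺ nonzero? (UniqueP.allFin⁺ N)) λ m → neighbours _ (proj₂ (∈-filter⁻ nonzero? {xs = allFin N} m))
    where
    nonzero? : U.Decidable (λ k → G i k ≢ 0)
    nonzero? k = ¬? (G i k ≟ 0)

  -- For symmetric G the diagonal summands of square commProd G i i are the pairs (G i k , G i k).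
  Equitable-row-↭ : {X G : Mat N} → Equitable commProd X → Refines X G → Symmetric G →
                    ∀ i s → X i i ≡ X s s → row G i ↭ row G s
  Equitable-row-↭ {X} {G} equitable X⊑G G-sym i s e = subst₂ _↭_ (row-square i) (row-square s)
    (map⁺ proj₂ (Equitable-coarsening commProd commProd-relabellingCompatible equitable X⊑G i i s s e))
    where
    row-square : ∀ a → map proj₂ (square commProd G a a) ≡ row G a
    row-square a = trans (sym (map-∘ (allFin N)))
      (map-cong (λ k → trans (cong (G a k ⊔_) (sym (G-sym a k))) (⊔-idem (G a k))) (allFin N))

Unique-length⇒complete : ∀ {m} {xs : List (Fin m)} → Unique xs → length xs ≡ m → ∀ q → q ∈ xs
Unique-length⇒complete {m} {xs} unique length≡m q with DecMembership._∈?_ FP._≟_ q xs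
... | yes q∈xs = q∈xs
... | no q∉xs = ⊥-elim (<-irrefl refl (begin-strict
  m                      ≡⟨ sym length≡m ⟩
  length xs              <⟨ n<1+n _ ⟩
  length (q ∷ xs)        ≤⟨ Unique-⊆⇒length≤ (¬Any⇒All¬ xs q∉xs ∷ unique) (λ _ → ∈-allFin _) ⟩
  length (allFin m)      ≡⟨ length-tabulate id ⟩
  m                      ∎))
  where open ≤-Reasoning

Pair : ℕ → Set
Pair n = Σ (Fin n × Fin n) λ (u , v) → u F.< v

Pair-≡ : ∀ {n} {p q : Pair n} → proj₁ p ≡ proj₁ q → p ≡ q
Pair-≡ {p = _ , u<v} {q = _ , u<v′} refl = cong (_ ,_) (<-irrelevant u<v u<v′)

pairs : ∀ n → List (Pair n)
pairs zero = []
pairs (suc n) = map withZero (allFin n) ++ map lift (pairs n)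
  module pairs where
  withZero : Fin n → Pair (suc n)
  withZero v = (F.zero , F.suc v) , s≤s z≤n
  lift : Pair n → Pair (suc n)
  lift ((u , v) , u<v) = (F.suc u , F.suc v) , s≤s u<v

pairs-unique : ∀ n → Unique (pairs n)
pairs-unique zero = []
pairs-unique (suc n) = UniqueP.++⁺ (UniqueP.map⁺ withZero-injective (UniqueP.allFin⁺ n))
                                   (UniqueP.map⁺ lift-injective (pairs-unique n)) disjoint
  where
  open pairs n
  withZero-injective : ∀ {v w} → withZero v ≡ withZero w → v ≡ w
  withZero-injective refl = refl
  lift-injective : ∀ {p q} → lift p ≡ lift q → p ≡ q
  lift-injective {(u , v) , _} {(u′ , v′) , _} e =
    Pair-≡ (cong₂ _,_ (FP.suc-injective (cong (proj₁ ∘ proj₁) e)) (FP.suc-injective (cong (proj₂ ∘ proj₁) e)))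
  disjoint : ∀ {p} → ¬ (p ∈ map withZero (allFin n) × p ∈ map lift (pairs n))
  disjoint (m₁ , m₂) with ∈-map⁻ withZero m₁ | ∈-map⁻ lift m₂
  ... | _ , _ , refl | _ , _ , ()

length-pairs : ∀ n → 2 * length (pairs n) + n ≡ n * n
length-pairs zero = refl
length-pairs (suc n) = begin
  2 * length (pairs (suc n)) + suc n      ≡⟨ cong (λ l → 2 * l + suc n) length-split ⟩
  2 * (n + length (pairs n)) + suc n      ≡⟨ regroup n (length (pairs n)) ⟩
  (2 * length (pairs n) + n) + (n + suc n) ≡⟨ cong (_+ (n + suc n)) (length-pairs n) ⟩
  n * n + (n + suc n)                     ≡⟨ square-suc n ⟩
  suc n * suc n                           ∎
  where
  open ≡-Reasoning
  open pairs n
  length-split : length (pairs (suc n)) ≡ n + length (pairs n)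
  length-split = trans (length-++ (map withZero (allFin n)))
    (cong₂ _+_ (trans (length-map withZero (allFin n)) (length-tabulate id)) (length-map lift (pairs n)))
  regroup : ∀ n l → 2 * (n + l) + suc n ≡ (2 * l + n) + (n + suc n)
  regroup = solve-∀
  square-suc : ∀ n → n * n + (n + suc n) ≡ suc n * suc n
  square-suc = solve-∀

module _ {N : ℕ} (G : Mat N) where

  isEdge⇒Edge : ∀ {i j} → isEdge G i j ≡ true → Edge G i j
  isEdge⇒Edge {i} {j} e with i F.≟ j | G i j ≟ 0
  isEdge⇒Edge () | yes _ | _
  isEdge⇒Edge () | no _ | yes _
  isEdge⇒Edge _ | no i≢j | no Gij≢0 = i≢j , Gij≢0

  Edge⇒isEdge : ∀ {i j} → Edge G i j → isEdge G i j ≡ true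
  Edge⇒isEdge {i} {j} (i≢j , Gij≢0) with i F.≟ j | G i j ≟ 0
  ... | yes i≡j | _ = ⊥-elim (i≢j i≡j)
  ... | no _ | yes Gij≡0 = ⊥-elim (Gij≢0 Gij≡0)
  ... | no _ | no _ = refl

  ¬isEdge⇒0 : ∀ {i j} → i ≢ j → isEdge G i j ≡ false → G i j ≡ 0
  ¬isEdge⇒0 {i} {j} i≢j e = decidable-stable (G i j ≟ 0)
    λ Gij≢0 → contradiction (trans (sym (Edge⇒isEdge (i≢j , Gij≢0))) e) λ ()

if-nonzero-injective : ∀ {b b′ : Bool} {a c : ℕ} → (b ≡ true → 1 ≤ a) → (b′ ≡ true → 1 ≤ c) →
                       (if b then a else 0) ≡ (if b′ then c else 0) → b ≡ b′
if-nonzero-injective {true} {true} _ _ _ = refl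
if-nonzero-injective {false} {false} _ _ _ = refl
if-nonzero-injective {true} {false} 1≤a _ e = contradiction (subst (1 ≤_) e (1≤a refl)) λ ()
if-nonzero-injective {false} {true} _ 1≤c e = contradiction (subst (1 ≤_) (sym e) (1≤c refl)) λ ()

avoid₂ : ∀ {n} → 2 < n → (a b : Fin n) → ∃ λ v → a ≢ v × b ≢ v
avoid₂ {suc (suc (suc _))} (s≤s (s≤s (s≤s z≤n))) a b with a F.≟ F.zero | b F.≟ F.zero
... | no a≢0 | no b≢0 = F.zero , a≢0 , b≢0
... | yes refl | _ with b F.≟ F.suc F.zero
...   | no b≢1 = F.suc F.zero , (λ ()) , b≢1
...   | yes refl = F.suc (F.suc F.zero) , (λ ()) , (λ ())
avoid₂ _ a b | no a≢0 | yes refl with a F.≟ F.suc F.zero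
...   | no a≢1 = F.suc F.zero , a≢1 , (λ ())
...   | yes refl = F.suc (F.suc F.zero) , (λ ()) , (λ ())

module BindingGraph {n m : ℕ} (A : Mat n) (B : Mat (n + m)) (isBinding : IsBindingGraph A B) where

  basic : Fin n → Fin (n + m)
  basic u = u ↑ˡ m

  binding : Fin m → Fin (n + m)
  binding q = n ↑ʳ q

  data Kind : Fin (n + m) → Set where
    basicᵏ   : (u : Fin n) → Kind (basic u)
    bindingᵏ : (q : Fin m) → Kind (binding q)

  kind : ∀ i → Kind i
  kind i = subst Kind (FP.join-splitAt n m i) (kind-join (F.splitAt n i))
    where
    kind-join : (s : Fin n ⊎ Fin m) → Kind (F.join n m s)
    kind-join (inj₁ u) = basicᵏ u
    kind-join (inj₂ q) = bindingᵏ q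

  basic-injective : ∀ {u v} → basic u ≡ basic v → u ≡ v
  basic-injective {u} {v} = FP.↑ˡ-injective m u v

  binding-injective : ∀ {p q} → binding p ≡ binding q → p ≡ q
  binding-injective {p} {q} = FP.↑ʳ-injective n p q

  toℕ-basic< : ∀ u → toℕ (basic u) < n
  toℕ-basic< u = subst (_< n) (sym (FP.toℕ-↑ˡ u m)) (FP.toℕ<n u)

  ≤toℕ-binding : ∀ q → n ≤ toℕ (binding q)
  ≤toℕ-binding q = subst (n ≤_) (sym (FP.toℕ-↑ʳ n q)) (m≤m+n n (toℕ q))

  basic≢binding : ∀ {u q} → basic u ≢ binding q
  basic≢binding {u} {q} e = <⇒≱ (toℕ-basic< u) (subst (λ i → n ≤ toℕ i) (sym e) (≤toℕ-binding q))

  isBindingVertex-basic : ∀ u → isBindingVertex {n} {m} (basic u) ≡ false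
  isBindingVertex-basic u with n ≤? toℕ (basic u)
  ... | yes n≤u = ⊥-elim (<⇒≱ (toℕ-basic< u) n≤u)
  ... | no _ = refl

  isBindingVertex-binding : ∀ q → isBindingVertex {n} {m} (binding q) ≡ true
  isBindingVertex-binding q with n ≤? toℕ (binding q)
  ... | yes _ = refl
  ... | no n≰q = ⊥-elim (n≰q (≤toℕ-binding q))

  isBindingEdgeᴮ : Fin (n + m) → Fin (n + m) → Bool
  isBindingEdgeᴮ = isBindingEdge {n} {m} B

  isBindingEdge-basic : ∀ u v → isBindingEdgeᴮ (basic u) (basic v) ≡ false
  isBindingEdge-basic u v rewrite isBindingVertex-basic u | isBindingVertex-basic v = ∧-zeroʳ _

  isBindingEdge-bindingˡ : ∀ q j → isBindingEdgeᴮ (binding q) j ≡ isEdge B (binding q) j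
  isBindingEdge-bindingˡ q j rewrite isBindingVertex-binding q = ∧-identityʳ _

  isBindingEdge-bindingʳ : ∀ i q → isBindingEdgeᴮ i (binding q) ≡ isEdge B i (binding q)
  isBindingEdge-bindingʳ i q rewrite isBindingVertex-binding q | ∨-zeroʳ (isBindingVertex {n} {m} i) = ∧-identityʳ _

  isBindingEdge⇒Edge : ∀ {i j} → isBindingEdgeᴮ i j ≡ true → Edge B i j
  isBindingEdge⇒Edge {i} {j} e with kind i | kind j
  ... | bindingᵏ q | _ = isEdge⇒Edge B (trans (sym (isBindingEdge-bindingˡ q j)) e)
  ... | basicᵏ u | bindingᵏ q = isEdge⇒Edge B (trans (sym (isBindingEdge-bindingʳ _ q)) e)
  ... | basicᵏ u | basicᵏ v = contradiction (trans (sym (isBindingEdge-basic u v)) e) λ ()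

  ¬isBindingEdge⇒basic-or-0 : ∀ {i j} → i ≢ j → isBindingEdgeᴮ i j ≡ false →
                              (∃₂ λ u v → i ≡ basic u × j ≡ basic v) ⊎ B i j ≡ 0
  ¬isBindingEdge⇒basic-or-0 {i} {j} i≢j e with kind i | kind j
  ... | basicᵏ u | basicᵏ v = inj₁ (u , v , refl , refl)
  ... | bindingᵏ q | _ = inj₂ (¬isEdge⇒0 B i≢j (trans (sym (isBindingEdge-bindingˡ q j)) e))
  ... | basicᵏ u | bindingᵏ q = inj₂ (¬isEdge⇒0 B i≢j (trans (sym (isBindingEdge-bindingʳ _ q)) e))

  B-simple : SimpleGraph B
  B-simple = proj₁ isBinding

  B-diagonal : ∀ i → B i i ≡ 0
  B-diagonal = proj₁ B-simple

  B-symmetric : Symmetric B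
  B-symmetric = proj₁ (proj₂ B-simple)

  B-induces-A : ∀ u v → B (basic u) (basic v) ≡ A u v
  B-induces-A = proj₁ (proj₂ isBinding)

  A-symmetric : Symmetric A
  A-symmetric u v = trans (sym (B-induces-A u v)) (trans (B-symmetric _ _) (B-induces-A v u))

  Edge-sym : ∀ {i j} → Edge B i j → Edge B j i
  Edge-sym {i} {j} (i≢j , Bij≢0) = i≢j ∘ sym , Bij≢0 ∘ trans (B-symmetric i j)

  Binds : Fin m → Fin n → Fin n → Set
  Binds q u v = ∀ w → Edge B (binding q) w ⇔′ (w ≡ basic u ⊎ w ≡ basic v)

  binder : ∀ u v → u ≢ v → Fin m
  binder u v u≢v = proj₁ (proj₂ (proj₂ isBinding) u v u≢v)

  binder-binds : ∀ u v (u≢v : u ≢ v) → Binds (binder u v u≢v) u v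
  binder-binds u v u≢v = proj₁ (proj₂ (proj₂ (proj₂ isBinding) u v u≢v))

  module _ {q u v} (q-binds : Binds q u v) where

    Binds-edgeˡ : Edge B (binding q) (basic u)
    Binds-edgeˡ = proj₂ (q-binds (basic u)) (inj₁ refl)

    Binds-edgeʳ : Edge B (binding q) (basic v)
    Binds-edgeʳ = proj₂ (q-binds (basic v)) (inj₂ refl)

    Binds-neighbour : ∀ {w} → Edge B (binding q) w → w ≡ basic u ⊎ w ≡ basic v
    Binds-neighbour {w} = proj₁ (q-binds w)

    Binds-isBindingEdgeˡ : isBindingEdgeᴮ (basic u) (binding q) ≡ true
    Binds-isBindingEdgeˡ = trans (isBindingEdge-bindingʳ (basic u) q) (Edge⇒isEdge B (Edge-sym Binds-edgeˡ))

    Binds-isBindingEdgeʳ : isBindingEdgeᴮ (binding q) (basic v) ≡ true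
    Binds-isBindingEdgeʳ = trans (isBindingEdge-bindingˡ q (basic v)) (Edge⇒isEdge B Binds-edgeʳ)

    Binds-basic-neighbour : ∀ {w} → Edge B (binding q) (basic w) → w ≡ u ⊎ w ≡ v
    Binds-basic-neighbour e = Sum.map basic-injective basic-injective (Binds-neighbour e)

    Binds-swap : Binds q v u
    Binds-swap w = Sum.swap ∘ proj₁ (q-binds w) , proj₂ (q-binds w) ∘ Sum.swap

    Binds-from-neighbours : ∀ {u′ v′} → u′ ≢ v′ → Edge B (binding q) (basic u′) → Edge B (binding q) (basic v′) →
                       Binds q u′ v′
    Binds-from-neighbours u′≢v′ e₁ e₂ with Binds-basic-neighbour e₁ | Binds-basic-neighbour e₂
    ... | inj₁ refl | inj₁ refl = ⊥-elim (u′≢v′ refl)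
    ... | inj₁ refl | inj₂ refl = q-binds
    ... | inj₂ refl | inj₁ refl = Binds-swap
    ... | inj₂ refl | inj₂ refl = ⊥-elim (u′≢v′ refl)

  pairBinder : Pair n → Fin m
  pairBinder ((u , v) , u<v) = binder u v (FP.<⇒≢ u<v)

  pairBinder-injective : ∀ {p p′} → pairBinder p ≡ pairBinder p′ → p ≡ p′
  pairBinder-injective {(u , v) , u<v} {(u′ , v′) , u′<v′} e
    with Binds-basic-neighbour (binder-binds u v (FP.<⇒≢ u<v))
           (subst (λ q → Edge B (binding q) (basic u′)) (sym e) (Binds-edgeˡ (binder-binds u′ v′ (FP.<⇒≢ u′<v′))))
       | Binds-basic-neighbour (binder-binds u v (FP.<⇒≢ u<v))
           (subst (λ q → Edge B (binding q) (basic v′)) (sym e) (Binds-edgeʳ (binder-binds u′ v′ (FP.<⇒≢ u′<v′))))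
  ... | inj₁ refl | inj₁ refl = ⊥-elim (FP.<⇒≢ u′<v′ refl)
  ... | inj₁ refl | inj₂ refl = Pair-≡ refl
  ... | inj₂ refl | inj₁ refl = ⊥-elim (<⇒≱ u<v (<⇒≤ u′<v′))
  ... | inj₂ refl | inj₂ refl = ⊥-elim (FP.<⇒≢ u′<v′ refl)

  -- With n(n+1)/2 vertices in all there are exactly as many binding vertices as pairs.
  module _ (vertex-count : 2 * (n + m) ≡ n * suc n) where

    length-pairs≡m : length (pairs n) ≡ m
    length-pairs≡m = *-cancelˡ-≡ (length (pairs n)) m 2 (+-cancelʳ-≡ _ _ _ (+-cancelʳ-≡ _ _ _ (begin
      2 * length (pairs n) + n + n   ≡⟨ cong (_+ n) (length-pairs n) ⟩
      n * n + n                      ≡⟨ n*n+n≡n*suc-n n ⟩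
      n * suc n                      ≡⟨ sym vertex-count ⟩
      2 * (n + m)                    ≡⟨ reorder n m ⟩
      2 * m + n + n                  ∎)))
      where
      open ≡-Reasoning
      n*n+n≡n*suc-n : ∀ n → n * n + n ≡ n * suc n
      n*n+n≡n*suc-n = solve-∀
      reorder : ∀ n m → 2 * (n + m) ≡ 2 * m + n + n
      reorder = solve-∀

    binds-some-pair : ∀ q → ∃₂ λ u v → u ≢ v × Binds q u v
    binds-some-pair q with ∈-map⁻ pairBinder
      (Unique-length⇒complete (UniqueP.map⁺ pairBinder-injective (pairs-unique n))
                              (trans (length-map pairBinder (pairs n)) length-pairs≡m) q)
    ... | ((u , v) , u<v) , _ , refl = u , v , FP.<⇒≢ u<v , binder-binds u v (FP.<⇒≢ u<v)

    degree-binding≤2 : ∀ q → degree B (binding q) ≤ 2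
    degree-binding≤2 q with binds-some-pair q
    ... | u , v , _ , q-binds = degree≤-neighbours {G = B} (basic u ∷ basic v ∷ []) neighbour
      where
      neighbour : ∀ k → B (binding q) k ≢ 0 → k ∈ basic u ∷ basic v ∷ []
      neighbour k Bqk≢0 with binding q F.≟ k
      ... | yes refl = ⊥-elim (Bqk≢0 (B-diagonal _))
      ... | no q≢k with Binds-neighbour q-binds (q≢k , Bqk≢0)
      ...   | inj₁ refl = here refl
      ...   | inj₂ refl = there (here refl)

  -- The neighbours: an A-neighbour w, and the binding vertices of {u, w} and {u, v′}.
  3≤degree-basic : 2 < n → Connected A → ∀ u → 3 ≤ degree B (basic u)
  3≤degree-basic 2<n A-connected u with avoid₂ 2<n u u
  ... | v , u≢v , _ with A-connected u v
  ...   | here = ⊥-elim (u≢v refl)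
  ...   | step {w = w} (u≢w , Auw≢0) _ with avoid₂ 2<n u w
  ...     | v′ , u≢v′ , w≢v′ =
    Unique-neighbours⇒≤degree {G = B} (basic w ∷ binding p ∷ binding p′ ∷ []) unique neighbour
    where
    p = binder u w u≢w
    p′ = binder u v′ u≢v′
    p≢p′ : p ≢ p′
    p≢p′ p≡p′ with Binds-basic-neighbour (binder-binds u w u≢w)
                     (subst (λ q → Edge B (binding q) (basic v′)) (sym p≡p′) (Binds-edgeʳ (binder-binds u v′ u≢v′)))
    ... | inj₁ v′≡u = u≢v′ (sym v′≡u)
    ... | inj₂ v′≡w = w≢v′ (sym v′≡w)
    unique : Unique (basic w ∷ binding p ∷ binding p′ ∷ [])
    unique = (basic≢binding ∷ basic≢binding ∷ []) ∷ ((p≢p′ ∘ binding-injective) ∷ []) ∷ [] ∷ []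
    neighbour : ∀ {k} → k ∈ basic w ∷ binding p ∷ binding p′ ∷ [] → B (basic u) k ≢ 0
    neighbour (here refl) = Auw≢0 ∘ trans (sym (B-induces-A u w))
    neighbour (there (here refl)) = proj₂ (Edge-sym (Binds-edgeˡ (binder-binds u w u≢w)))
    neighbour (there (there (here refl))) = proj₂ (Edge-sym (Binds-edgeˡ (binder-binds u v′ u≢v′)))

  module StableGraph (vertex-count : 2 * (n + m) ≡ n * suc n) (2<n : 2 < n) (A-connected : Connected A)
                     {M : Mat (n + m)} (M-stable : IsStable B M) where

    private
      module M = ResultProperties (IsResult⇒properties commProd-injectiveUpToSwap commProd-relabellingCompatible M-stable)

    M-separating : DiagonalSeparating M
    M-separating = RefinesInit.separating M.refinesInit

    M-symmetric : Symmetric M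
    M-symmetric = M.symmetric commProd-comm B-symmetric

    M-positive-on-Edge : ∀ {i j} → Edge B i j → 1 ≤ M i j
    M-positive-on-Edge (_ , Bij≢0) = M.positive _ _ (inj₂ Bij≢0)

    M-refines-B : Refines M B
    M-refines-B i j s t e with i F.≟ j
    ... | yes refl = trans (B-diagonal i) (sym (subst (λ t′ → B s t′ ≡ 0) (M-separating i s t e) (B-diagonal s)))
    ... | no i≢j = RefinesInit.offDiagonal M.refinesInit i j s t i≢j e

    M-preserves-Edge : ∀ {i j s t} → Edge B i j → M i j ≡ M s t → Edge B s t
    M-preserves-Edge (i≢j , Bij≢0) e = DiagonalSeparating-≢ M-separating i≢j e , Bij≢0 ∘ trans (M-refines-B _ _ _ _ e)

    -- Basic vertices have degree at least 3 in B, binding vertices at most 2.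
    M-basic≢binding : ∀ {u q} → M (basic u) (basic u) ≢ M (binding q) (binding q)
    M-basic≢binding {u} {q} e = <-irrefl refl (begin
      3                     ≤⟨ 3≤degree-basic 2<n A-connected u ⟩
      degree B (basic u)    ≡⟨ row-↭⇒degree-≡ {G = B} (Equitable-row-↭ M.equitable M-refines-B B-symmetric _ _ e) ⟩
      degree B (binding q)  ≤⟨ degree-binding≤2 vertex-count q ⟩
      2                     ∎)
      where open ≤-Reasoning

    M-basic≢bindingRow : ∀ {u v q k} → M (basic u) (basic v) ≢ M (binding q) k
    M-basic≢bindingRow e = Sum.[ M-basic≢binding ∘ sym , M-basic≢binding ∘ sym ]
      (proj₁ (Equitable-diagonal-ends commProd commProd-injectiveUpToSwap M.equitable M-separating _ _ _ _ (sym e)))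

    -- Compare the summands through basic v of the squares at the two entries.
    M-binding-edge-determines-A : ∀ {p p′ u v w z} → Binds p u v → Binds p′ w z → u ≢ v →
                                  M (binding p) (basic u) ≡ M (binding p′) (basic w) → A u v ≡ A w z
    M-binding-edge-determines-A {p} {p′} {u} {v} {w} {z} p-binds p′-binds u≢v e
      with square-↭-match commProd M (M.equitable _ _ _ _ e) (basic v)
    ... | k , e′ with commProd-injectiveUpToSwap e′
    ... | inj₂ (_ , Mvu≡Mp′k) = ⊥-elim (M-basic≢bindingRow Mvu≡Mp′k)
    ... | inj₁ (Mpv≡Mp′k , Mvu≡Mkw) with Binds-neighbour p′-binds (M-preserves-Edge (Binds-edgeʳ p-binds) Mpv≡Mp′k)
    ...   | inj₁ refl = ⊥-elim (u≢v (sym (basic-injective (M-separating _ _ _ (sym Mvu≡Mkw)))))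
    ...   | inj₂ refl = begin
      A u v                    ≡⟨ A-symmetric u v ⟩
      A v u                    ≡⟨ sym (B-induces-A v u) ⟩
      B (basic v) (basic u)    ≡⟨ M-refines-B _ _ _ _ Mvu≡Mkw ⟩
      B (basic z) (basic w)    ≡⟨ B-induces-A z w ⟩
      A z w                    ≡⟨ A-symmetric z w ⟩
      A w z                    ∎
      where open ≡-Reasoning

    M-binding-diagonal-determines-A : ∀ {p p′ u v u′ v′} → Binds p u v → Binds p′ u′ v′ → u ≢ v →
                                      M (binding p) (binding p) ≡ M (binding p′) (binding p′) → A u v ≡ A u′ v′
    M-binding-diagonal-determines-A {p} {p′} {u} {v} {u′} {v′} p-binds p′-binds u≢v e
      with square-↭-match commProd M (M.equitable _ _ _ _ e) (basic u)
    ... | k , e′ = through-neighbour {k} (Sum.[ proj₁ , trans (M-symmetric _ _) ∘ proj₂ ] (commProd-injectiveUpToSwap e′))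
      where
      through-neighbour : ∀ {k} → M (binding p) (basic u) ≡ M (binding p′) k → A u v ≡ A u′ v′
      through-neighbour e with Binds-neighbour p′-binds (M-preserves-Edge (Binds-edgeˡ p-binds) e)
      ... | inj₁ refl = M-binding-edge-determines-A p-binds p′-binds u≢v e
      ... | inj₂ refl = trans (M-binding-edge-determines-A p-binds (Binds-swap p′-binds) u≢v e) (A-symmetric _ _)

    Φ : Mat (n + m)
    Φ = PhiGraph {n} {m} B M

    Φ-diagonal : ∀ i → Φ i i ≡ M i i
    Φ-diagonal i with i F.≟ i
    ... | yes _ = refl
    ... | no i≢i = ⊥-elim (i≢i refl)

    Φ-offDiagonal : ∀ {i j} → i ≢ j → Φ i j ≡ (if isBindingEdgeᴮ i j then M i j else 0)
    Φ-offDiagonal {i} {j} i≢j with i F.≟ j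
    ... | yes i≡j = ⊥-elim (i≢j i≡j)
    ... | no _ = refl

    module _ (x : Label) (1≤x : 1 ≤ x) where

      Θ : Mat (n + m)
      Θ = ThetaGraph {n} {m} B Φ x

      Θ-offDiagonal : ∀ {i j} → i ≢ j → Θ i j ≡ (if isBindingEdgeᴮ i j then x else 0)
      Θ-offDiagonal {i} {j} i≢j with i F.≟ j
      ... | yes i≡j = ⊥-elim (i≢j i≡j)
      ... | no _ = refl

      Θ-basic : ∀ u → Θ (basic u) (basic u) ≡ 0
      Θ-basic u with basic u F.≟ basic u
      ... | no u≢u = ⊥-elim (u≢u refl)
      ... | yes _ rewrite isBindingVertex-basic u = refl

      Θ-binding : ∀ q → Θ (binding q) (binding q) ≡ M (binding q) (binding q)
      Θ-binding q with binding q F.≟ binding q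
      ... | no q≢q = ⊥-elim (q≢q refl)
      ... | yes _ rewrite isBindingVertex-binding q = refl

      M-diagonal⇒Θ-diagonal : ∀ i s → M i i ≡ M s s → Θ i i ≡ Θ s s
      M-diagonal⇒Θ-diagonal i s e with kind i | kind s
      ... | basicᵏ u | basicᵏ v = trans (Θ-basic u) (sym (Θ-basic v))
      ... | bindingᵏ p | bindingᵏ q = trans (Θ-binding p) (trans e (sym (Θ-binding q)))
      ... | basicᵏ u | bindingᵏ q = ⊥-elim (M-basic≢binding e)
      ... | bindingᵏ p | basicᵏ v = ⊥-elim (M-basic≢binding (sym e))

      RefinesInit-Φ⇒Θ : {X : Mat (n + m)} → RefinesInit X Φ → RefinesInit X Θ
      RefinesInit-Φ⇒Θ {X} (mkRefinesInit separating diagonal offDiagonal) = mkRefinesInit separating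
        (λ i s e → M-diagonal⇒Θ-diagonal i s (trans (sym (Φ-diagonal i)) (trans (diagonal i s e) (Φ-diagonal s))))
        Θ-offDiagonal-refined
        where
        Θ-offDiagonal-refined : ∀ i j s t → i ≢ j → X i j ≡ X s t → Θ i j ≡ Θ s t
        Θ-offDiagonal-refined i j s t i≢j e = begin
          Θ i j                                  ≡⟨ Θ-offDiagonal i≢j ⟩
          (if isBindingEdgeᴮ i j then x else 0)  ≡⟨ cong (λ b → if b then x else 0) same-edge-kind ⟩
          (if isBindingEdgeᴮ s t then x else 0)  ≡⟨ sym (Θ-offDiagonal s≢t) ⟩
          Θ s t                                  ∎
          where
          open ≡-Reasoning
          s≢t = DiagonalSeparating-≢ separating i≢j e
          same-edge-kind : isBindingEdgeᴮ i j ≡ isBindingEdgeᴮ s t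
          same-edge-kind = if-nonzero-injective (M-positive-on-Edge ∘ isBindingEdge⇒Edge)
            (M-positive-on-Edge ∘ isBindingEdge⇒Edge)
            (trans (sym (Φ-offDiagonal i≢j)) (trans (offDiagonal i j s t i≢j e) (Φ-offDiagonal s≢t)))

      module _ {prod : Product} (injective : InjectiveUpToSwap prod) (determines : DeterminesCommProd prod)
               {X : Mat (n + m)} (X-equitable : Equitable prod X) (X-init : RefinesInit X Θ) where

        open RefinesInit X-init

        X-diagonal-ends : ∀ {i j s t} → X i j ≡ X s t →
                          (X i i ≡ X s s ⊎ X i i ≡ X t t) × (X j j ≡ X s s ⊎ X j j ≡ X t t)
        X-diagonal-ends = Equitable-diagonal-ends prod injective X-equitable separating _ _ _ _

        X-binding≢basic : ∀ {q u} → X (binding q) (binding q) ≢ X (basic u) (basic u)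
        X-binding≢basic {q} {u} e = contradiction
          (subst (1 ≤_) (trans (sym (Θ-binding q)) (trans (diagonal _ _ e) (Θ-basic u))) (M.positive _ _ (inj₁ refl)))
          λ ()

        X-basic≢bindingˡ : ∀ {u v q t} → X (basic u) (basic v) ≢ X (binding q) t
        X-basic≢bindingˡ e = Sum.[ X-binding≢basic , X-binding≢basic ] (proj₁ (X-diagonal-ends (sym e)))

        X-basic≢bindingʳ : ∀ {u v s q} → X (basic u) (basic v) ≢ X s (binding q)
        X-basic≢bindingʳ e = Sum.[ X-binding≢basic , X-binding≢basic ] (proj₂ (X-diagonal-ends (sym e)))

        X-basic-pair-closed : ∀ {u v s t} → X (basic u) (basic v) ≡ X s t → ∃₂ λ u′ v′ → s ≡ basic u′ × t ≡ basic v′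
        X-basic-pair-closed {s = s} {t} e with kind s | kind t
        ... | basicᵏ u′ | basicᵏ v′ = u′ , v′ , refl , refl
        ... | bindingᵏ q | _ = ⊥-elim (X-basic≢bindingˡ e)
        ... | basicᵏ _ | bindingᵏ q = ⊥-elim (X-basic≢bindingʳ e)

        X-preserves-isBindingEdge : ∀ {i j s t} → i ≢ j → X i j ≡ X s t → isBindingEdgeᴮ i j ≡ isBindingEdgeᴮ s t
        X-preserves-isBindingEdge i≢j e = if-nonzero-injective (λ _ → 1≤x) (λ _ → 1≤x)
          (trans (sym (Θ-offDiagonal i≢j)) (trans (offDiagonal _ _ _ _ i≢j e) (Θ-offDiagonal (DiagonalSeparating-≢ separating i≢j e))))

        binding-path⇒A : ∀ {p u v u′ v′ k} → Binds p u v → u ≢ v → u′ ≢ v′ →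
                         isBindingEdgeᴮ (basic u′) k ≡ true → isBindingEdgeᴮ k (basic v′) ≡ true →
                         X (binding p) (binding p) ≡ X k k ⊎ X (binding p) (binding p) ≡ X (basic v′) (basic v′) →
                         A u v ≡ A u′ v′
        binding-path⇒A _ _ _ _ _ (inj₂ e) = ⊥-elim (X-binding≢basic e)
        binding-path⇒A {k = k} p-binds u≢v u′≢v′ u′k kv′ (inj₁ e) with kind k
        ... | basicᵏ w = contradiction (trans (sym (isBindingEdge-basic _ w)) u′k) λ ()
        ... | bindingᵏ q = M-binding-diagonal-determines-A p-binds q-binds u≢v
          (trans (sym (Θ-binding _)) (trans (diagonal _ _ e) (Θ-binding q)))
          where
          q-binds = Binds-from-neighbours (proj₂ (proj₂ (proj₂ (binds-some-pair vertex-count q)))) u′≢v′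
                                     (Edge-sym (isBindingEdge⇒Edge u′k)) (isBindingEdge⇒Edge kv′)

        -- The summand through the binding vertex p of the pair {u, v}.
        X-basic-pair⇒A : ∀ {p u v u′ v′} → Binds p u v → u ≢ v → u′ ≢ v′ →
                         X (basic u) (basic v) ≡ X (basic u′) (basic v′) → A u v ≡ A u′ v′
        X-basic-pair⇒A {p} p-binds u≢v u′≢v′ e with square-↭-match prod X (X-equitable _ _ _ _ e) (binding p)
        ... | k , e′ with injective e′
        ... | inj₁ (e₁ , e₂) = binding-path⇒A p-binds u≢v u′≢v′
          (trans (sym (X-preserves-isBindingEdge basic≢binding e₁)) (Binds-isBindingEdgeˡ p-binds))
          (trans (sym (X-preserves-isBindingEdge (basic≢binding ∘ sym) e₂)) (Binds-isBindingEdgeʳ p-binds))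
          (proj₁ (X-diagonal-ends e₂))
        ... | inj₂ (e₁ , e₂) = binding-path⇒A p-binds u≢v u′≢v′
          (trans (sym (X-preserves-isBindingEdge (basic≢binding ∘ sym) e₂)) (Binds-isBindingEdgeʳ p-binds))
          (trans (sym (X-preserves-isBindingEdge basic≢binding e₁)) (Binds-isBindingEdgeˡ p-binds))
          (proj₂ (X-diagonal-ends e₁))

        X-basic-pair⇒B : ∀ {u v u′ v′} → basic u ≢ basic v →
                         X (basic u) (basic v) ≡ X (basic u′) (basic v′) → B (basic u) (basic v) ≡ B (basic u′) (basic v′)
        X-basic-pair⇒B {u} {v} {u′} {v′} u≢v e = begin
          B (basic u) (basic v)    ≡⟨ B-induces-A u v ⟩
          A u v                    ≡⟨ X-basic-pair⇒A (binder-binds u v (u≢v ∘ cong basic)) (u≢v ∘ cong basic)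
                                        (DiagonalSeparating-≢ separating u≢v e ∘ cong basic) e ⟩
          A u′ v′                  ≡⟨ sym (B-induces-A u′ v′) ⟩
          B (basic u′) (basic v′)  ∎
          where open ≡-Reasoning

        X-offDiagonal⇒B : ∀ i j s t → i ≢ j → X i j ≡ X s t → B i j ≡ B s t
        X-offDiagonal⇒B i j s t i≢j e with isBindingEdgeᴮ i j in ij | isBindingEdgeᴮ s t in st
        ... | true | true = SimpleGraph⇒nonzero-entries-equal B-simple i j s t
          (proj₂ (isBindingEdge⇒Edge ij)) (proj₂ (isBindingEdge⇒Edge st))
        ... | true | false = contradiction (trans (sym ij) (trans (X-preserves-isBindingEdge i≢j e) st)) λ ()
        ... | false | true = contradiction (trans (sym ij) (trans (X-preserves-isBindingEdge i≢j e) st)) λ ()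
        ... | false | false with ¬isBindingEdge⇒basic-or-0 i≢j ij
        ...   | inj₁ (u , v , refl , refl) with X-basic-pair-closed e
        ...     | _ , _ , refl , refl = X-basic-pair⇒B i≢j e
        X-offDiagonal⇒B i j s t i≢j e | false | false | inj₂ Bij≡0
          with ¬isBindingEdge⇒basic-or-0 (DiagonalSeparating-≢ separating i≢j e) st
        ... | inj₂ Bst≡0 = trans Bij≡0 (sym Bst≡0)
        ... | inj₁ (u′ , v′ , refl , refl) with X-basic-pair-closed (sym e)
        ...   | _ , _ , refl , refl = X-basic-pair⇒B i≢j e

        X-refines-M : Refines X M
        X-refines-M = M.coarsest (Equitable-commProd prod determines X-equitable)
          (mkRefinesInit separating (λ i s _ → trans (B-diagonal i) (sym (B-diagonal s))) X-offDiagonal⇒B)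

        Equitable-RefinesInit-Θ⇒Φ : RefinesInit X Φ
        Equitable-RefinesInit-Θ⇒Φ = mkRefinesInit separating
          (λ i s e → trans (Φ-diagonal i) (trans (X-refines-M i i s s e) (sym (Φ-diagonal s))))
          Φ-offDiagonal-refined
          where
          Φ-offDiagonal-refined : ∀ i j s t → i ≢ j → X i j ≡ X s t → Φ i j ≡ Φ s t
          Φ-offDiagonal-refined i j s t i≢j e
            rewrite Φ-offDiagonal i≢j | Φ-offDiagonal (DiagonalSeparating-≢ separating i≢j e)
                  | X-preserves-isBindingEdge i≢j e with isBindingEdgeᴮ s t
          ... | true = X-refines-M i j s t e
          ... | false = refl

      Φ-Θ-results-≈ : ∀ {prod} → InjectiveUpToSwap prod → RelabellingCompatible prod → DeterminesCommProd prod →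
                      {S T : Mat (n + m)} → IsResult prod Φ S → IsResult prod Θ T → S ≈ T
      Φ-Θ-results-≈ injective compatible determines = results-≈ injective compatible
        (λ _ _ → RefinesInit-Φ⇒Θ)
        (λ _ X-equitable → Equitable-RefinesInit-Θ⇒Φ injective determines X-equitable)

theorem9 : ∀ {n m} (A : Mat n) (B : Mat (n + m)) →
    2 < n → SimpleGraph A → Connected A →
    2 * (n + m) ≡ n * suc n →
    IsBindingGraph A B →
    (M : Mat (n + m)) → IsStable B M →
    (x : ℕ) → 1 ≤ x → (∀ i j → PhiGraph {n} {m} B M i j ≢ x) →
    ((S T : Mat (n + m)) →
       IsStable (PhiGraph {n} {m} B M) S →
       IsStable (ThetaGraph {n} {m} B (PhiGraph {n} {m} B M) x) T → S ≈ T)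
    × ((U V : Mat (n + m)) →
       IsWL (PhiGraph {n} {m} B M) U →
       IsWL (ThetaGraph {n} {m} B (PhiGraph {n} {m} B M) x) V → U ≈ V)
theorem9 A B 2<n _ A-connected vertex-count isBinding M M-stable x 1≤x _ =
  (λ _ _ → Φ-Θ-results-≈ x 1≤x commProd-injectiveUpToSwap commProd-relabellingCompatible commProd-determinesCommProd) ,
  (λ _ _ → Φ-Θ-results-≈ x 1≤x wlProd-injectiveUpToSwap wlProd-relabellingCompatible wlProd-determinesCommProd)
  where open BindingGraph.StableGraph A B isBinding vertex-count 2<n A-connected M-stable
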